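{- Let $G_s$ be a strongly connected digraph with start vertex $s$, let $r$ be either a marked vertex of $G_s$ or $s$, and let $H_r=H(G_s,r)$. Let $(x,y)$ be an edge of $H_r$ such that $y$ is an ordinary vertex of $H_r$. Then $r$ can reach every vertex of $H_r$ in $H_r\setminus(x,y)$.
   Context: Digraphs may have multiple edges. For a strongly connected digraph $G_s$ with start vertex $s$: $u$ dominates $v$ if every path from $s$ to $v$ contains $u$; the dominator tree $D(G_s)$ is rooted at $s$ with $u$ an ancestor of $v$ iff $u$ dominates $v$; $d(v)$ is the parent of $v\ne s$, $D(r)$ the set of descendants of $r$. An edge $(u,v)$ is a bridge of $G_s$ if every path from $s$ to $v$ uses it; then $v$ is marked. Deleting from $D(G_s)$ the edges $(d(v),v)$ for all marked $v$ splits it into subtrees; $T(r)$ is the subtree rooted at $r$. The auxiliary graph $H(G_s,r)$ is obtained from $G_s$ by contracting, for every marked $z$ with $d(z)\in T(r)$, the set $D(z)$ into the vertex $z$, and, if $r\neq s$, contracting $V(G_s)\setminus D(r)$ into the vertex $d(r)$; resulting self-loops are removed and every edge of multiplicity at least two is kept with multiplicity two. Vertices of $T(r)$ are ordinary in $H(G_s,r)$; the others are auxiliary. -}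

module Defs where

open import Data.Nat using (ℕ)
open import Data.Fin using (Fin; _<_)
open import Data.Product using (Σ; ∃; ∃-syntax; _×_; _,_)
open import Data.Sum using (_⊎_)
open import Data.Empty using (⊥)
open import Relation.Nullary using (¬_)
open import Relation.Binary.PropositionalEquality using (_≡_; _≢_)
open import Relation.Binary.Construct.Closure.ReflexiveTransitive using (Star)

-- A finite directed multigraph on vertex set Fin n: edges are indexed by
-- Fin m, edge e goes from src e to tgt e (parallel edges and loops allowed).
record Digraph (n : ℕ) : Set where
  field
    m   : ℕ
    src : Fin m → Fin n
    tgt : Fin m → Fin n
open Digraph public

module _ {n : ℕ} (G : Digraph n) where

  data Walk : Fin n → Fin n → Set where
    []   : ∀ {u} → Walk u u
    step : ∀ {u v} (e : Fin (m G)) → src G e ≡ u → Walk (tgt G e) v → Walk u v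

  data VisitsV (x : Fin n) : ∀ {u v} → Walk u v → Set where
    here  : ∀ {v} (w : Walk x v) → VisitsV x w
    there : ∀ {u v} {e : Fin (m G)} {p : src G e ≡ u} {w : Walk (tgt G e) v}
            → VisitsV x w → VisitsV x (step e p w)

  data UsesE (f : Fin (m G)) : ∀ {u v} → Walk u v → Set where
    here  : ∀ {u v} {p : src G f ≡ u} {w : Walk (tgt G f) v} → UsesE f (step f p w)
    there : ∀ {u v} {e : Fin (m G)} {p : src G e ≡ u} {w : Walk (tgt G e) v}
            → UsesE f w → UsesE f (step e p w)

  StronglyConnected : Set
  StronglyConnected = ∀ u v → Walk u v

  module _ (s : Fin n) where

    Dom : Fin n → Fin n → Set
    Dom u v = (w : Walk s v) → VisitsV u w

    IDom : Fin n → Fin n → Set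
    IDom d v = v ≢ s × Dom d v × d ≢ v × (∀ w → Dom w v → w ≢ v → Dom w d)

    Bridge : Fin (m G) → Set
    Bridge e = (w : Walk s (tgt G e)) → UsesE e w

    Marked : Fin n → Set
    Marked v = ∃[ e ] (tgt G e ≡ v × Bridge e)

    -- v ∈ T(r): v ∈ D(r) and no marked vertex z ≠ r lies on the
    -- dominator-tree path from r to v
    InT : Fin n → Fin n → Set
    InT r v = Dom r v × (∀ z → Marked z → z ≢ r → Dom r z → Dom z v → ⊥)

    -- Rep r w h : vertex w of G_s is represented by vertex h of H(G_s,r)
    -- (w ∈ T(r) stays itself; w ∈ D(z) for marked z with d(z) ∈ T(r) goes to z;
    --  if r ≠ s, w ∉ D(r) goes to d(r))
    Rep : Fin n → Fin n → Fin n → Set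
    Rep r w h =
        (InT r w × h ≡ w)
      ⊎ ((Marked h × (∃[ d ] (IDom d h × InT r d)) × Dom h w)
      ⊎ (r ≢ s × ¬ Dom r w × IDom h r))

    HVertex : Fin n → Fin n → Set
    HVertex r h = ∃[ w ] Rep r w h

    -- the edge e of G_s becomes an edge (a,b) of H (after contraction,
    -- not a self-loop)
    Image : Fin n → Fin (m G) → Fin n → Fin n → Set
    Image r e a b = Rep r (src G e) a × Rep r (tgt G e) b × a ≢ b

    -- Edges of H(G_s,r): the images of G-edges, where for each pair (a,b)
    -- only the first two G-edges (by index) mapping to (a,b) are kept,
    -- so every multiplicity ≥ 2 becomes exactly 2.
    HEdge : Fin n → Fin (m G) → Fin n → Fin n → Set
    HEdge r e a b = Image r e a b ×
      ¬ (∃[ e₁ ] ∃[ e₂ ] (e₁ < e₂ × e₂ < e × Image r e₁ a b × Image r e₂ a b))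

    HStepWithout : Fin n → Fin (m G) → Fin n → Fin n → Set
    HStepWithout r e₀ a b = ∃[ e ] (e ≢ e₀ × HEdge r e a b)

    HReachWithout : Fin n → Fin (m G) → Fin n → Fin n → Set
    HReachWithout r e₀ = Star (HStepWithout r e₀)

-- Since y ∈ T(r), either y = r or the edge e₀ into y is not a bridge of G_s; in both
-- cases some walk of G_s from r to y avoids e₀, and from y every vertex is reachable
-- without re-entering y, hence without e₀.  Every vertex h of H_r is the image of a
-- vertex t all of whose images are h (t ∈ T(r) itself, a block root z, or s for the
-- contracted d(r)), so it suffices to project a walk r ⇝ t avoiding e₀ into H_r.
-- Projection works because an edge leaving a vertex with an image again ends at a
-- vertex with an image: either it stays in the contracted block, or the first marked
-- vertex below r dominating its head is the head itself.
module Submission where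

open import Defs
open import Data.Nat as ℕ using (ℕ; zero; suc; _+_; _≤_)
import Data.Nat.Properties as ℕP
open import Data.Fin using (Fin; _<_)
open import Data.Fin.Properties using (_≟_; _<?_; any?; all?; <-trans; <-irrefl)
open import Data.Fin.Induction using (<-wellFounded)
open import Data.Fin.Subset using (Subset; _∈_; _∉_; _⊆_; ⁅_⁆; _∪_; ∣_∣)
open import Data.Fin.Subset.Properties
  using (_∈?_; x∈⁅x⁆; x∈⁅y⁆⇒x≡y; x∈p∪q⁻; p⊆p∪q; q⊆p∪q; p⊂q⇒∣p∣<∣q∣; ∣p∣≤n)
open import Data.Product using (Σ; ∃; _×_; _,_; proj₁; proj₂)
open import Data.Sum using (_⊎_; inj₁; inj₂; [_,_]′)
open import Data.Empty using (⊥-elim)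
open import Function using (_∘_; id)
open import Induction.WellFounded using (Acc; acc)
open import Relation.Nullary using (¬_; Dec; yes; no)
open import Relation.Nullary.Decidable
  using (_×-dec_; _⊎-dec_; _→-dec_; ¬?; map′; decidable-stable)
open import Relation.Unary using (Decidable)
open import Relation.Binary.PropositionalEquality
  using (_≡_; _≢_; refl; sym; subst)
open import Relation.Binary.Construct.Closure.ReflexiveTransitive using (ε; _◅_)

module WalkProperties {n : ℕ} (G : Digraph n) where

  infixr 5 _++_
  _++_ : ∀ {u v w} → Walk G u v → Walk G v w → Walk G u w
  []         ++ q = q
  step e p w ++ q = step e p (w ++ q)

  trivial-walk : ∀ {f u v} → u ≡ v → Σ (Walk G u v) λ w → ¬ UsesE G f w
  trivial-walk refl = [] , λ ()

  visits-end : ∀ {u v} (w : Walk G u v) → VisitsV G v w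
  visits-end []           = here []
  visits-end (step _ _ w) = there (visits-end w)

  ++-visitsˡ : ∀ {x u v w} {p : Walk G u v} {q : Walk G v w} →
               VisitsV G x p → VisitsV G x (p ++ q)
  ++-visitsˡ {q = q} (here w) = here (w ++ q)
  ++-visitsˡ (there i)        = there (++-visitsˡ i)

  ++-visits⁻ : ∀ {x u v w} (p : Walk G u v) {q : Walk G v w} →
               VisitsV G x (p ++ q) → VisitsV G x p ⊎ VisitsV G x q
  ++-visits⁻ []           i         = inj₂ i
  ++-visits⁻ (step _ _ _) (here _)  = inj₁ (here _)
  ++-visits⁻ (step _ _ w) (there i) with ++-visits⁻ w i
  ... | inj₁ i′ = inj₁ (there i′)
  ... | inj₂ i′ = inj₂ i′

  ++-uses⁻ : ∀ {f u v w} (p : Walk G u v) {q : Walk G v w} →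
             UsesE G f (p ++ q) → UsesE G f p ⊎ UsesE G f q
  ++-uses⁻ []           i         = inj₂ i
  ++-uses⁻ (step _ _ _) here      = inj₁ here
  ++-uses⁻ (step _ _ w) (there i) with ++-uses⁻ w i
  ... | inj₁ i′ = inj₁ (there i′)
  ... | inj₂ i′ = inj₂ i′

  uses⇒visits-src : ∀ {f u v} {w : Walk G u v} → UsesE G f w → VisitsV G (src G f) w
  uses⇒visits-src (here {p = refl}) = here _
  uses⇒visits-src (there i)         = there (uses⇒visits-src i)

  uses⇒visits-tgt : ∀ {f u v} {w : Walk G u v} → UsesE G f w → VisitsV G (tgt G f) w
  uses⇒visits-tgt (here {w = w}) = there (here w)
  uses⇒visits-tgt (there i)      = there (uses⇒visits-tgt i)

  prefix : ∀ {x u v} {w : Walk G u v} → VisitsV G x w → Walk G u x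
  prefix (here _)                  = []
  prefix (there {e = e} {p = p} i) = step e p (prefix i)

  suffix : ∀ {x u v} {w : Walk G u v} → VisitsV G x w → Walk G x v
  suffix (here w)  = w
  suffix (there i) = suffix i

  prefix-visits : ∀ {x y u v} {w : Walk G u v} (i : VisitsV G x w) →
                  VisitsV G y (prefix i) → VisitsV G y w
  prefix-visits (here _)  (here _)  = here _
  prefix-visits (there _) (here _)  = here _
  prefix-visits (there i) (there j) = there (prefix-visits i j)

  suffix-visits : ∀ {x y u v} {w : Walk G u v} (i : VisitsV G x w) →
                  VisitsV G y (suffix i) → VisitsV G y w
  suffix-visits (here _)  j = j
  suffix-visits (there i) j = there (suffix-visits i j)

  suffix-uses : ∀ {x f u v} {w : Walk G u v} (i : VisitsV G x w) →
                UsesE G f (suffix i) → UsesE G f w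
  suffix-uses (here _)  j = j
  suffix-uses (there i) j = there (suffix-uses i j)

  visits? : ∀ x {u v} (w : Walk G u v) → Dec (VisitsV G x w)
  visits? x {u} w with x ≟ u
  visits? x []           | yes refl = yes (here [])
  visits? x (step _ _ _) | yes refl = yes (here _)
  visits? x []           | no x≢u   = no λ { (here _) → x≢u refl }
  visits? x (step _ _ w) | no x≢u with visits? x w
  ... | yes i = yes (there i)
  ... | no ¬i = no λ { (here _) → x≢u refl ; (there i) → ¬i i }

  uses? : ∀ f {u v} (w : Walk G u v) → Dec (UsesE G f w)
  uses? f [] = no λ ()
  uses? f (step e _ w) with f ≟ e | uses? f w
  ... | yes refl | _     = yes here
  ... | no _     | yes i = yes (there i)
  ... | no f≢e   | no ¬i = no λ { here → f≢e refl ; (there i) → ¬i i }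

  record Entry (u x : Fin n) : Set where
    constructor entry
    field
      {last} : Fin n
      before : Walk G u last
      avoids : ¬ VisitsV G x before
      edge   : Fin (m G)
      from   : src G edge ≡ last
      into   : tgt G edge ≡ x

  firstEntry : ∀ {u x} → u ≢ x → Walk G u x → Entry u x
  firstEntry u≢x [] = ⊥-elim (u≢x refl)
  firstEntry {x = x} u≢x (step e p w) with tgt G e ≟ x
  ... | yes into = entry [] (λ { (here _) → u≢x refl }) e p into
  ... | no t≢x with firstEntry t≢x w
  ...   | entry P ¬x∈P e′ from into =
    entry (step e p P) (λ { (here _) → u≢x refl ; (there i) → ¬x∈P i }) e′ from into

  record Exit (x v : Fin n) : Set where
    constructor exit
    field
      edge   : Fin (m G)
      from   : src G edge ≡ x
      after  : Walk G (tgt G edge) v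
      avoids : ¬ VisitsV G x after

  lastExit : ∀ {x u v} → x ≢ v → (w : Walk G u v) → VisitsV G x w → Exit x v
  lastExit x≢v [] (here _) = ⊥-elim (x≢v refl)
  lastExit {x} x≢v (step _ _ w) _ with visits? x w
  ... | yes j = lastExit x≢v w j
  lastExit x≢v (step e p w) (here _)  | no ¬j = exit e p w ¬j
  lastExit x≢v (step e p w) (there j) | no ¬j = ⊥-elim (¬j j)

  data AllE (Q : Fin (m G) → Set) : ∀ {u v} → Walk G u v → Set where
    []  : ∀ {u} → AllE Q ([] {u = u})
    _∷_ : ∀ {u v e} {p : src G e ≡ u} {w : Walk G (tgt G e) v} →
          Q e → AllE Q w → AllE Q (step e p w)

  ++-all : ∀ {Q u v w} {p : Walk G u v} {q : Walk G v w} →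
           AllE Q p → AllE Q q → AllE Q (p ++ q)
  ++-all []       b = b
  ++-all (x ∷ a) b = x ∷ ++-all a b

  all-tgt≢⇒¬visits : ∀ {x u v} (w : Walk G u v) → u ≢ x →
                     AllE (λ e → tgt G e ≢ x) w → ¬ VisitsV G x w
  all-tgt≢⇒¬visits _            u≢x _       (here _)  = u≢x refl
  all-tgt≢⇒¬visits (step _ _ w) _   (t≢x ∷ a) (there i) = all-tgt≢⇒¬visits w t≢x a i

  ¬visits⇒all-tgt≢ : ∀ {x u v} (w : Walk G u v) → ¬ VisitsV G x w →
                     AllE (λ e → tgt G e ≢ x) w
  ¬visits⇒all-tgt≢ []           _  = []
  ¬visits⇒all-tgt≢ (step e _ w) ¬i =
    (λ { refl → ¬i (there (here w)) }) ∷ ¬visits⇒all-tgt≢ w (¬i ∘ there)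

  all-≢⇒¬uses : ∀ {f u v} (w : Walk G u v) → AllE (_≢ f) w → ¬ UsesE G f w
  all-≢⇒¬uses (step _ _ _) (e≢f ∷ _) here      = e≢f refl
  all-≢⇒¬uses (step _ _ w) (_ ∷ a)   (there i) = all-≢⇒¬uses w a i

  ¬uses⇒all-≢ : ∀ {f u v} (w : Walk G u v) → ¬ UsesE G f w → AllE (_≢ f) w
  ¬uses⇒all-≢ []           _  = []
  ¬uses⇒all-≢ (step _ _ w) ¬i = (λ { refl → ¬i here }) ∷ ¬uses⇒all-≢ w (¬i ∘ there)

  module Reachability (Q : Fin (m G) → Set) (Q? : Decidable Q) (u : Fin n) where

    Reach : Fin n → Set
    Reach v = Σ (Walk G u v) (AllE Q)

    AllReachable : Subset n → Set
    AllReachable p = ∀ {x} → x ∈ p → Reach x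

    Closed : Subset n → Set
    Closed p = ∀ e → Q e → src G e ∈ p → tgt G e ∈ p

    closed-reach : ∀ {p z v} → Closed p → z ∈ p → (w : Walk G z v) → AllE Q w → v ∈ p
    closed-reach _      z∈p []              []      = z∈p
    closed-reach closed z∈p (step e refl w) (q ∷ a) = closed-reach closed (closed e q z∈p) w a

    add-tgt : ∀ {p} e → Q e → src G e ∈ p → AllReachable p → AllReachable (p ∪ ⁅ tgt G e ⁆)
    add-tgt {p} e q s∈p reach x∈ with x∈p∪q⁻ p ⁅ tgt G e ⁆ x∈
    ... | inj₁ x∈p = reach x∈p
    ... | inj₂ x∈t with x∈⁅y⁆⇒x≡y _ x∈t
    ...   | refl with reach s∈p
    ...     | w , a = w ++ step e refl [] , ++-all a (q ∷ [])

    add-tgt-grows : ∀ {p} e → tgt G e ∉ p → ∣ p ∣ ℕ.< ∣ p ∪ ⁅ tgt G e ⁆ ∣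
    add-tgt-grows {p} e t∉p =
      p⊂q⇒∣p∣<∣q∣ (p⊆p∪q _ , tgt G e , q⊆p∪q p _ (x∈⁅x⁆ _) , t∉p)

    -- k is fuel: at least the number of vertices not yet in p.
    saturate : ∀ k p → n ≤ k + ∣ p ∣ → AllReachable p →
               ∃ λ q → p ⊆ q × AllReachable q × Closed q
    saturate k p bound reach with any? (λ e → Q? e ×-dec src G e ∈? p ×-dec ¬? (tgt G e ∈? p)) | k
    ... | no none | _ =
      p , id , reach ,
      λ e q s∈p → decidable-stable (tgt G e ∈? p) λ t∉p → none (e , q , s∈p , t∉p)
    ... | yes (e , _ , _ , t∉p) | zero =
      ⊥-elim (ℕP.<⇒≱ (add-tgt-grows e t∉p) (ℕP.≤-trans (∣p∣≤n (p ∪ ⁅ tgt G e ⁆)) bound))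
    ... | yes (e , q , s∈p , t∉p) | suc k′
      with saturate k′ (p ∪ ⁅ tgt G e ⁆) bound′ (add-tgt e q s∈p reach)
      where
      bound′ : n ≤ k′ + ∣ p ∪ ⁅ tgt G e ⁆ ∣
      bound′ = ℕP.≤-trans bound (ℕP.≤-trans (ℕP.≤-reflexive (sym (ℕP.+-suc k′ _)))
                                             (ℕP.+-monoʳ-≤ k′ (add-tgt-grows e t∉p)))
    ...   | c , p′⊆c , reach′ , closed = c , p′⊆c ∘ p⊆p∪q _ , reach′ , closed

    reach? : ∀ v → Dec (Reach v)
    reach? v with saturate n ⁅ u ⁆ (ℕP.m≤m+n n _) start
      where
      start : AllReachable ⁅ u ⁆
      start x∈ with x∈⁅y⁆⇒x≡y u x∈
      ... | refl = [] , []
    ... | q , u⊆q , reach , closed =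
      map′ reach (λ { (w , a) → closed-reach closed (u⊆q (x∈⁅x⁆ u)) w a }) (v ∈? q)

module Dominance {n : ℕ} (G : Digraph n) (s : Fin n) (sc : StronglyConnected G) where
  open WalkProperties G

  avoiding-vertex? : ∀ x v → Dec (Σ (Walk G s v) λ w → ¬ VisitsV G x w)
  avoiding-vertex? x v with s ≟ x
  ... | yes refl = no λ { (w , ¬i) → ¬i (here w) }
  ... | no s≢x =
    map′ (λ { (w , a) → w , all-tgt≢⇒¬visits w s≢x a })
         (λ { (w , ¬i) → w , ¬visits⇒all-tgt≢ w ¬i })
         (Reachability.reach? (λ e → tgt G e ≢ x) (λ e → ¬? (tgt G e ≟ x)) s v)

  avoiding-edge? : ∀ f v → Dec (Σ (Walk G s v) λ w → ¬ UsesE G f w)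
  avoiding-edge? f v =
    map′ (λ { (w , a) → w , all-≢⇒¬uses w a })
         (λ { (w , ¬i) → w , ¬uses⇒all-≢ w ¬i })
         (Reachability.reach? (_≢ f) (λ e → ¬? (e ≟ f)) s v)

  ¬avoiding⇒Dom : ∀ {u v} → ¬ (Σ (Walk G s v) λ w → ¬ VisitsV G u w) → Dom G s u v
  ¬avoiding⇒Dom {u} none w = decidable-stable (visits? u w) λ ¬i → none (w , ¬i)

  ¬avoiding⇒Bridge : ∀ {f} → ¬ (Σ (Walk G s (tgt G f)) λ w → ¬ UsesE G f w) → Bridge G s f
  ¬avoiding⇒Bridge {f} none w = decidable-stable (uses? f w) λ ¬i → none (w , ¬i)

  Dom? : ∀ u v → Dec (Dom G s u v)
  Dom? u v = map′ ¬avoiding⇒Dom (λ d (w , ¬i) → ¬i (d w)) (¬? (avoiding-vertex? u v))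

  ¬Dom⇒avoiding : ∀ {u v} → ¬ Dom G s u v → Σ (Walk G s v) λ w → ¬ VisitsV G u w
  ¬Dom⇒avoiding {u} {v} ¬d = decidable-stable (avoiding-vertex? u v) (¬d ∘ ¬avoiding⇒Dom)

  ¬Bridge⇒avoiding : ∀ {f} → ¬ Bridge G s f → Σ (Walk G s (tgt G f)) λ w → ¬ UsesE G f w
  ¬Bridge⇒avoiding {f} ¬b = decidable-stable (avoiding-edge? f (tgt G f)) (¬b ∘ ¬avoiding⇒Bridge)

  Bridge? : ∀ f → Dec (Bridge G s f)
  Bridge? f = map′ ¬avoiding⇒Bridge (λ b (w , ¬i) → ¬i (b w)) (¬? (avoiding-edge? f (tgt G f)))

  Marked? : ∀ v → Dec (Marked G s v)
  Marked? v = any? λ e → (tgt G e ≟ v) ×-dec Bridge? e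

  IDom? : ∀ d v → Dec (IDom G s d v)
  IDom? d v = ¬? (v ≟ s) ×-dec Dom? d v ×-dec ¬? (d ≟ v) ×-dec
              all? λ w → Dom? w v →-dec ¬? (w ≟ v) →-dec Dom? w d

  InT? : ∀ r v → Dec (InT G s r v)
  InT? r v = Dom? r v ×-dec
             all? λ z → Marked? z →-dec ¬? (z ≟ r) →-dec Dom? r z →-dec Dom? z v →-dec no λ ()

  Rep? : ∀ r w h → Dec (Rep G s r w h)
  Rep? r w h =
        (InT? r w ×-dec h ≟ w)
    ⊎-dec (Marked? h ×-dec any? (λ d → IDom? d h ×-dec InT? r d) ×-dec Dom? h w)
    ⊎-dec (¬? (r ≟ s) ×-dec ¬? (Dom? r w) ×-dec IDom? h r)

  Image? : ∀ r e a b → Dec (Image G s r e a b)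
  Image? r e a b = Rep? r (src G e) a ×-dec Rep? r (tgt G e) b ×-dec ¬? (a ≟ b)

  dom-refl : ∀ v → Dom G s v v
  dom-refl v = visits-end

  start-dom : ∀ v → Dom G s s v
  start-dom v = here

  dom-start : ∀ {x} → Dom G s x s → x ≡ s
  dom-start d with d []
  ... | here _ = refl

  dom-trans : ∀ {a b c} → Dom G s a b → Dom G s b c → Dom G s a c
  dom-trans ab bc w = prefix-visits (bc w) (ab (prefix (bc w)))

  dom-src : ∀ {z} e → Dom G s z (tgt G e) → z ≢ tgt G e → Dom G s z (src G e)
  dom-src e d z≢t w with ++-visits⁻ w (d (w ++ step e refl []))
  ... | inj₁ i                = i
  ... | inj₂ (here _)         = visits-end w
  ... | inj₂ (there (here _)) = ⊥-elim (z≢t refl)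

  dom-antisym : ∀ {a b} → Dom G s a b → Dom G s b a → a ≡ b
  dom-antisym {a} {b} ab ba with a ≟ b | s ≟ a
  ... | yes a≡b | _ = a≡b
  ... | no _ | yes refl = sym (dom-start ba)
  ... | no a≢b | no s≢a with firstEntry s≢a (sc s a)
  ...   | entry P ¬a∈P e refl refl with ++-visits⁻ P (ba (P ++ step e refl []))
  ...     | inj₁ b∈P              = ⊥-elim (¬a∈P (prefix-visits b∈P (ab (prefix b∈P))))
  ...     | inj₂ (here _)         = ⊥-elim (¬a∈P (ab P))
  ...     | inj₂ (there (here _)) = ⊥-elim (a≢b refl)

  dom-total : ∀ {a b v} → Dom G s a v → Dom G s b v → ¬ Dom G s a b → Dom G s b a
  dom-total {a} {b} {v} av bv ¬ab Q with a ≟ v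
  ... | yes refl = bv Q
  ... | no a≢v with lastExit a≢v (sc a v) (here _)
  ...   | exit e p R ¬a∈R with ++-visits⁻ Q (bv (Q ++ step e p R))
  ...     | inj₁ b∈Q         = b∈Q
  ...     | inj₂ (here _)    = ⊥-elim (¬ab (dom-refl a))
  ...     | inj₂ (there b∈R) with ¬Dom⇒avoiding ¬ab
  ...       | P , ¬a∈P with ++-visits⁻ P (av (P ++ suffix b∈R))
  ...         | inj₁ a∈P = ⊥-elim (¬a∈P a∈P)
  ...         | inj₂ a∈R = ⊥-elim (¬a∈R (suffix-visits b∈R a∈R))

  bridge-tgt≢start : ∀ e → Bridge G s e → tgt G e ≢ s
  bridge-tgt≢start e br t≡s with trivial-walk (sym t≡s)
  ... | w , ¬uses = ¬uses (br w)

  no-self-bridge : ∀ {f v} → s ≢ v → ((w : Walk G s v) → UsesE G f w) → src G f ≢ v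
  no-self-bridge s≢v br src≡v with firstEntry s≢v (sc s _)
  ... | entry P ¬v∈P e refl refl with ++-uses⁻ P (br (P ++ step e refl []))
  ...   | inj₁ f∈P = ¬v∈P (subst (λ z → VisitsV G z P) src≡v (uses⇒visits-src f∈P))
  ...   | inj₂ here = ¬v∈P (subst (λ z → VisitsV G z P) src≡v (visits-end P))

  bridge⇒idom : ∀ e → Bridge G s e → IDom G s (src G e) (tgt G e)
  bridge⇒idom e br =
    bridge-tgt≢start e br , uses⇒visits-src ∘ br ,
    no-self-bridge (bridge-tgt≢start e br ∘ sym) br , λ _ → dom-src e

  idom⇒dom : ∀ {d v} → IDom G s d v → Dom G s d v
  idom⇒dom (_ , dv , _) = dv

  idom-maximal : ∀ {d v w} → IDom G s d v → Dom G s w v → w ≢ v → Dom G s w d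
  idom-maximal (_ , _ , _ , maximal) = maximal _

  idom⇒¬dom : ∀ {d v} → IDom G s d v → ¬ Dom G s v d
  idom⇒¬dom (_ , dv , d≢v , _) vd = d≢v (dom-antisym dv vd)

  idom-unique : ∀ {a b v} → IDom G s a v → IDom G s b v → a ≡ b
  idom-unique ia ib = dom-antisym (idom-maximal ib (idom⇒dom ia) (proj₁ (proj₂ (proj₂ ia))))
                                  (idom-maximal ia (idom⇒dom ib) (proj₁ (proj₂ (proj₂ ib))))

  marked⇒idom : ∀ {v} → Marked G s v → ∃ λ d → IDom G s d v
  marked⇒idom (e , refl , br) = src G e , bridge⇒idom e br

  walk-from-head-avoiding : ∀ f t → Σ (Walk G (tgt G f) t) λ w → ¬ UsesE G f w
  walk-from-head-avoiding f t with tgt G f ≟ t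
  ... | yes y≡t = trivial-walk y≡t
  ... | no y≢t with lastExit y≢t (sc (tgt G f) t) (here _)
  ...   | exit e p R ¬y∈R =
    step e p R , λ { here → ¬y∈R (here R) ; (there i) → ¬y∈R (uses⇒visits-tgt i) }

module AuxiliaryGraph {n : ℕ} (G : Digraph n) (s : Fin n) (sc : StronglyConnected G)
                      (r : Fin n) (r-root : Marked G s r ⊎ r ≡ s) where
  open WalkProperties G
  open Dominance G s sc

  MarkedBelow : Fin n → Set
  MarkedBelow z = Marked G s z × z ≢ r × Dom G s r z

  InT⇒¬markedBelow-dom : ∀ {v z} → InT G s r v → MarkedBelow z → ¬ Dom G s z v
  InT⇒¬markedBelow-dom (_ , none) (mz , z≢r , rz) = none _ mz z≢r rz

  InT-root : InT G s r r
  InT-root = dom-refl r , λ _ _ z≢r rz zr → z≢r (dom-antisym zr rz)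

  r≢s⇒idom : r ≢ s → ∃ λ d → IDom G s d r
  r≢s⇒idom r≢s = [ marked⇒idom , ⊥-elim ∘ r≢s ]′ r-root

  block-root⇒markedBelow : ∀ {d z} → Marked G s z → IDom G s d z → InT G s r d → MarkedBelow z
  block-root⇒markedBelow mz idd d∈T =
    mz , (λ { refl → idom⇒¬dom idd (proj₁ d∈T) }) , dom-trans (proj₁ d∈T) (idom⇒dom idd)

  data Position (v : Fin n) : Set where
    in-T    : InT G s r v → Position v
    below   : ∀ {z} → MarkedBelow z → Dom G s z v → Position v
    outside : ¬ Dom G s r v → Position v

  position : ∀ v → Position v
  position v with Dom? r v
  ... | no ¬rv = outside ¬rv
  ... | yes rv with any? (λ z → Marked? z ×-dec ¬? (z ≟ r) ×-dec Dom? r z ×-dec Dom? z v)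
  ...   | yes (_ , mz , z≢r , rz , zv) = below (mz , z≢r , rz) zv
  ...   | no none = in-T (rv , λ z mz z≢r rz zv → none (z , mz , z≢r , rz , zv))

  MarkedOnlyAt : Fin n → Set
  MarkedOnlyAt v = ∀ {z} → MarkedBelow z → Dom G s z v → z ≡ v

  markedOnlyAt-tgt : ∀ e → (∀ {z} → MarkedBelow z → Dom G s z (tgt G e) → ¬ Dom G s z (src G e)) →
                     MarkedOnlyAt (tgt G e)
  markedOnlyAt-tgt e none {z} mz zt with z ≟ tgt G e
  ... | yes z≡t = z≡t
  ... | no z≢t  = ⊥-elim (none mz zt (dom-src e zt z≢t))

  rep-below : ∀ {v z} → MarkedOnlyAt v → MarkedBelow z → Dom G s z v → Rep G s r v v
  rep-below {v} only mz zv with only mz zv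
  rep-below {v} only (mv , v≢r , rv) _ | refl with marked⇒idom mv
  ... | d , idd = inj₂ (inj₁ (mv , (d , idd , d∈T) , dom-refl v))
    where
    d∈T : InT G s r d
    d∈T = idom-maximal idd rv (v≢r ∘ sym) ,
          λ _ mz z≢r rz zd → idom⇒¬dom idd
            (subst (λ x → Dom G s x d) (only (mz , z≢r , rz) (dom-trans zd (idom⇒dom idd))) zd)

  ¬dom⇒r≢s : ∀ {v} → ¬ Dom G s r v → r ≢ s
  ¬dom⇒r≢s {v} ¬rv r≡s = ¬rv (subst (λ x → Dom G s x v) (sym r≡s) (start-dom v))

  rep-outside : ∀ {v} → ¬ Dom G s r v → ∃ (Rep G s r v)
  rep-outside ¬rv with r≢s⇒idom (¬dom⇒r≢s ¬rv)
  ... | d , idd = d , inj₂ (inj₂ (¬dom⇒r≢s ¬rv , ¬rv , idd))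

  rep-at : ∀ {v} → MarkedOnlyAt v → Position v → ∃ (Rep G s r v)
  rep-at _    (in-T v∈T)   = _ , inj₁ (v∈T , refl)
  rep-at only (below mz zv) = _ , rep-below only mz zv
  rep-at _    (outside ¬rv) = rep-outside ¬rv

  rep-step : ∀ {v a} → Rep G s r v a → ∀ e → src G e ≡ v → ∃ (Rep G s r (tgt G e))
  rep-step (inj₁ (v∈T , _)) e refl =
    rep-at (markedOnlyAt-tgt e λ mz _ → InT⇒¬markedBelow-dom v∈T mz) (position _)
  rep-step (inj₂ (inj₂ (_ , ¬rv , _))) e refl =
    rep-at (markedOnlyAt-tgt e λ (_ , _ , rz) _ zv → ¬rv (dom-trans rz zv)) (position _)
  rep-step {a = z} (inj₂ (inj₁ (mz , (d , idd , d∈T) , zv))) e refl with Dom? z (tgt G e)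
  ... | yes zt = z , inj₂ (inj₁ (mz , (d , idd , d∈T) , zt))
  ... | no ¬zt = rep-at (markedOnlyAt-tgt e escapes) (position _)
    where
    -- z′ lies strictly above z on the dominator chain of v, so it dominates d(z) ∈ T(r).
    escapes : ∀ {z′} → MarkedBelow z′ → Dom G s z′ (tgt G e) → ¬ Dom G s z′ (src G e)
    escapes mz′ z′t z′v = InT⇒¬markedBelow-dom d∈T mz′ (idom-maximal idd z′z z′≢z)
      where
      z′z = dom-total zv z′v (¬zt ∘ λ zz′ → dom-trans zz′ z′t)
      z′≢z = λ { refl → ¬zt z′t }

  rep-into-T : ∀ {w y} → InT G s r y → Rep G s r w y → y ≡ w
  rep-into-T _ (inj₁ (_ , y≡w)) = y≡w
  rep-into-T {y = y} y∈T (inj₂ (inj₁ (my , (_ , idd , d∈T) , _))) =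
    ⊥-elim (InT⇒¬markedBelow-dom y∈T (block-root⇒markedBelow my idd d∈T) (dom-refl y))
  rep-into-T y∈T (inj₂ (inj₂ (_ , _ , idy))) = ⊥-elim (idom⇒¬dom idy (proj₁ y∈T))

  rep-of-T : ∀ {w b} → InT G s r w → Rep G s r w b → b ≡ w
  rep-of-T _ (inj₁ (_ , b≡w)) = b≡w
  rep-of-T w∈T (inj₂ (inj₁ (mb , (_ , idd , d∈T) , bw))) =
    ⊥-elim (InT⇒¬markedBelow-dom w∈T (block-root⇒markedBelow mb idd d∈T) bw)
  rep-of-T w∈T (inj₂ (inj₂ (_ , ¬rw , _))) = ⊥-elim (¬rw (proj₁ w∈T))

  rep-of-block-root : ∀ {h d b} → IDom G s d h → InT G s r d → Rep G s r h b → b ≡ h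
  rep-of-block-root _ _ (inj₁ (_ , b≡h)) = b≡h
  rep-of-block-root {h} {b = b} idd d∈T (inj₂ (inj₁ (mb , (_ , idd′ , d′∈T) , bh))) with b ≟ h
  ... | yes b≡h = b≡h
  ... | no b≢h  = ⊥-elim (InT⇒¬markedBelow-dom d∈T (block-root⇒markedBelow mb idd′ d′∈T)
                                                (idom-maximal idd bh b≢h))
  rep-of-block-root idd d∈T (inj₂ (inj₂ (_ , ¬rh , _))) =
    ⊥-elim (¬rh (dom-trans (proj₁ d∈T) (idom⇒dom idd)))

  rep-of-start : ∀ {d b} → r ≢ s → IDom G s d r → Rep G s r s b → b ≡ d
  rep-of-start r≢s _ (inj₁ (s∈T , _)) = ⊥-elim (r≢s (dom-start (proj₁ s∈T)))
  rep-of-start _ _ (inj₂ (inj₁ (mb , _ , bs))) =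
    ⊥-elim (proj₁ (proj₂ (marked⇒idom mb)) (dom-start bs))
  rep-of-start _ idd (inj₂ (inj₂ (_ , _ , idb))) = idom-unique idb idd

  canonical-preimage : ∀ {h} → HVertex G s r h → ∃ λ t → ∀ {b} → Rep G s r t b → b ≡ h
  canonical-preimage (w , inj₁ (w∈T , refl))                    = w , rep-of-T w∈T
  canonical-preimage (_ , inj₂ (inj₁ (_ , (_ , idd , d∈T) , _))) = _ , rep-of-block-root idd d∈T
  canonical-preimage (_ , inj₂ (inj₂ (r≢s , _ , idh)))           = s , rep-of-start r≢s idh

  InT⇒¬bridge : ∀ {f} → InT G s r (tgt G f) → r ≢ tgt G f → ¬ Bridge G s f
  InT⇒¬bridge y∈T r≢y br =
    InT⇒¬markedBelow-dom y∈T ((_ , refl , br) , r≢y ∘ sym , proj₁ y∈T) (dom-refl _)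

  walk-from-root-avoiding : ∀ {f} → InT G s r (tgt G f) → ∀ t →
                            Σ (Walk G r t) λ w → ¬ UsesE G f w
  walk-from-root-avoiding {f} y∈T t with r ≟ tgt G f
  ... | yes r≡y = subst (λ x → Σ (Walk G x t) λ w → ¬ UsesE G f w) (sym r≡y)
                        (walk-from-head-avoiding f t)
  ... | no r≢y with ¬Bridge⇒avoiding (InT⇒¬bridge y∈T r≢y) | walk-from-head-avoiding f t
  ...   | P , ¬f∈P | Q , ¬f∈Q = suffix r∈PQ , λ i → ¬f∈PQ (suffix-uses r∈PQ i)
    where
    r∈PQ : VisitsV G r (P ++ Q)
    r∈PQ = ++-visitsˡ (proj₁ y∈T P)
    ¬f∈PQ : ¬ UsesE G f (P ++ Q)
    ¬f∈PQ i = [ ¬f∈P , ¬f∈Q ]′ (++-uses⁻ P i)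

  module _ (e₀ : Fin (m G)) where

    image⇒hstep : ∀ {a b} e → Image G s r e a b → e ≢ e₀ → HStepWithout G s r e₀ a b
    image⇒hstep e = go e (<-wellFounded e)
      where
      -- Among two earlier parallel images at least one differs from e₀.
      go : ∀ {a b} e → Acc _<_ e → Image G s r e a b → e ≢ e₀ → HStepWithout G s r e₀ a b
      go {a} {b} e (acc smaller) img e≢e₀
        with any? (λ e₁ → any? λ e₂ →
               e₁ <? e₂ ×-dec e₂ <? e ×-dec Image? r e₁ a b ×-dec Image? r e₂ a b)
      ... | no none = e , e≢e₀ , img , none
      ... | yes (e₁ , e₂ , e₁<e₂ , e₂<e , img₁ , img₂) with e₁ ≟ e₀
      ...   | no e₁≢e₀ = go e₁ (smaller (<-trans e₁<e₂ e₂<e)) img₁ e₁≢e₀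
      ...   | yes refl = go e₂ (smaller e₂<e) img₂ λ { refl → <-irrefl refl e₁<e₂ }

    project : ∀ {u t a} → Rep G s r u a → (w : Walk G u t) → ¬ UsesE G e₀ w →
              ∃ λ b → Rep G s r t b × HReachWithout G s r e₀ a b
    project {a = a} rep [] _ = a , rep , ε
    project {a = a} rep (step e refl w) ¬uses with rep-step rep e refl
    ... | a′ , rep′ with project rep′ w (¬uses ∘ there)
    ...   | b , rep-b , path with a ≟ a′
    ...     | yes refl = b , rep-b , path
    ...     | no a≢a′  =
      b , rep-b , image⇒hstep e (rep , rep′ , a≢a′) (λ { refl → ¬uses here }) ◅ path

    reach-preimage : InT G s r (tgt G e₀) → ∀ t {h} → (∀ {b} → Rep G s r t b → b ≡ h) →
                     HReachWithout G s r e₀ r h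
    reach-preimage y∈T t images-are-h with walk-from-root-avoiding y∈T t
    ... | w , ¬e₀∈w with project (inj₁ (InT-root , refl)) w ¬e₀∈w
    ...   | b , rep-b , path = subst (HReachWithout G s r e₀ r) (images-are-h rep-b) path

lemma8 : ∀ {n} (G : Digraph n) (s : Fin n) → StronglyConnected G →
         (r : Fin n) → Marked G s r ⊎ r ≡ s →
         (e₀ : Fin (m G)) (x y : Fin n) → HEdge G s r e₀ x y → InT G s r y →
         (h : Fin n) → HVertex G s r h → HReachWithout G s r e₀ r h
lemma8 G s sc r r-root e₀ _ y ((_ , rep-y , _) , _) y∈T h hv =
  let t , images-are-h = canonical-preimage hv
  in reach-preimage e₀ (subst (InT G s r) (rep-into-T y∈T rep-y) y∈T) t images-are-h
  where open AuxiliaryGraph G s sc r r-root
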